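{- Let $s\geq 1$, $k\geq 1$ and $p\geq 1$ be integers, and let $n_1,\dots,n_p$ be positive integers with $n_1\geq sk+1$ and $n_i\geq sk$ for $i=2,\dots,p$. Let \[ \mathcal{A}_{(1,1)}^{s,k}(n_1,\dots,n_p)=\{A\in[n_1,\dots,n_p]_k^s:\ (1,1)\in A\}. \] Then, with $N=\sum_{i=1}^p n_i$, \[ \left|\mathcal{A}_{(1,1)}^{s,k}(n_1,\dots,n_p)\right| = \binom{N-sk-1}{k-1}. \]
   Context: For positive integers $n_1,\dots,n_p$, let $[n]=\{1,\dots,n\}$ and $[n_1,\dots,n_p]=([n_1]\times\{1\})\cup\cdots\cup([n_p]\times\{p\})$; the elements with second coordinate $i$ are regarded as arranged in cyclic order $1,2,\dots,n_i$ around the $i$-th circle (so $n_i$ is followed by $1$). A subset of $[n_1,\dots,n_p]$ is $s$-separated if no two of its elements lie in the same circle with fewer than $s$ elements of that circle between them; i.e. for any two distinct elements $(a,i),(b,i)$ of the set in the same circle of size $n_i$, both $|a-b|-1\geq s$ and $n_i-|a-b|-1\geq s$. Elements in different circles impose no restriction. $[n_1,\dots,n_p]_k^s$ denotes the set of $s$-separated $k$-element subsets of $[n_1,\dots,n_p]$. -}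

module Defs where

open import Data.Nat using (ℕ; _≤_; _∸_; _+_; ∣_-_∣)
open import Data.Nat.Combinatorics using (_C_)
open import Data.Fin using (Fin; toℕ)
open import Data.Fin.Subset using (Subset; _∈_; ∣_∣)
open import Data.List using (List; []; _∷_; length)
open import Data.List.Relation.Unary.Unique.Propositional using (Unique)
open import Data.List.Membership.Propositional renaming (_∈_ to _∈ₗ_)
open import Data.Product using (Σ; _×_; ∃; _,_)
open import Data.Unit using (⊤)
open import Function.Bundles using (_⇔_)
open import Relation.Binary.PropositionalEquality using (_≡_; _≢_)

-- A subset of [n₁,…,nₚ], given by the list of circle sizes (n₁ ∷ … ∷ nₚ):
-- one subset of Fin nᵢ per circle. Element a : Fin nᵢ of circle i stands for (toℕ a + 1 , i).
Family : List ℕ → Set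
Family []       = ⊤
Family (m ∷ ms) = Subset m × Family ms

size : (ms : List ℕ) → Family ms → ℕ
size []       _        = 0
size (m ∷ ms) (A , F)  = ∣ A ∣ + size ms F

SeparatedCircle : ℕ → (m : ℕ) → Subset m → Set
SeparatedCircle s m A =
  (a b : Fin m) → a ≢ b → a ∈ A → b ∈ A →
  (s ≤ ∣ toℕ a - toℕ b ∣ ∸ 1) × (s ≤ m ∸ ∣ toℕ a - toℕ b ∣ ∸ 1)

Separated : ℕ → (ms : List ℕ) → Family ms → Set
Separated s []       _       = ⊤
Separated s (m ∷ ms) (A , F) = SeparatedCircle s m A × Separated s ms F

SepK : ℕ → ℕ → (ms : List ℕ) → Family ms → Set
SepK s k ms F = Separated s ms F × size ms F ≡ k

Contains11 : (n₁ : ℕ) (ms : List ℕ) → Family (n₁ ∷ ms) → Set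
Contains11 n₁ ms (A , _) = Σ (Fin n₁) λ a → (toℕ a ≡ 0) × (a ∈ A)

𝒜 : ℕ → ℕ → (n₁ : ℕ) (ms : List ℕ) → Family (n₁ ∷ ms) → Set
𝒜 s k n₁ ms F = SepK s k (n₁ ∷ ms) F × Contains11 n₁ ms F

HasCard : {ms : List ℕ} → (Family ms → Set) → ℕ → Set
HasCard {ms} P c =
  Σ (List (Family ms)) λ L → Unique L × ((F : Family ms) → (F ∈ₗ L) ⇔ P F) × (length L ≡ c)

module Submission where

-- Counting s-separated k-subsets of a union of circles through (1,1), by
-- generating functions: series ℕ → ℕ multiplied by Cauchy product _⋆_.
-- For fixed s, path m has coefficients C(m - s(d-1), d), counting separated
-- d-subsets of a path of m cells; it satisfies path (m+1) = path m + X·path (m-s).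
-- From this recurrence we derive a shift lemma (moving cells between two paths
-- does not change their product in low degree) and a window identity
-- (classify subsets of a long path by their element in a window of s cells).
-- Together they give the merge lemma: path L ⋆ cycle n = path (L+n) in
-- degrees j with s·j ≤ L+s and s(j+1) ≤ n, where cycle n = path (n-s) +
-- s·X·path (n-2s-1).  Combinatorially, a decision procedure for "spread" subsets
-- of Fin n shows that cycle n counts separated subsets of a circle, and that
-- the sets through (1,1) of the first circle are counted by X·path (n₁-2s-1).
-- Generating functions multiply over circles, so the sets in question are
-- counted by X·path (n₁-2s-1) ⋆ ∏ cycle nᵢ = X·path (N-2s-1), whose degree-k
-- coefficient is C(N-sk-1, k-1); they are enumerated by filtering all families.

open import Defs
open import Data.Nat using (ℕ; zero; suc; _+_; _*_; _∸_; _≤_; _<_; z≤n; s≤s; s≤s⁻¹; _⊓_; pred; ∣_-_∣; _≡ᵇ_)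
open import Data.Nat.Properties
open import Data.Nat.Combinatorics using (_C_; nC1≡n; nCk+nC[k+1]≡[n+1]C[k+1]; k>n⇒nCk≡0; nCk≡nC[n∸k]; nCn≡1)
open import Data.Nat.ListAction using (sum)
open import Data.Nat.ListAction.Properties using (sum-++)
open import Data.List.Properties using (map-++; map-∘)
open import Data.Nat.Solver using (module +-*-Solver)
open import Data.Bool using (Bool; true; false; _∧_)
open import Data.Bool.Properties using (∧-conicalˡ; ∧-conicalʳ; T-≡) renaming (_≟_ to _≟B_)
open import Data.Unit using (tt)
open import Data.Empty using (⊥-elim)
open import Data.Product using (_×_; _,_; proj₁; proj₂)
open import Data.Sum using (inj₁; inj₂)
open import Data.Fin using (toℕ) renaming (zero to fzero; suc to fsuc)
import Data.Fin.Properties as Fin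
open import Data.Fin.Subset using (Subset; _∈_; ∣_∣)
open import Data.Vec using ([]; _∷_; head)
open import Data.Vec.Base using (here; there)
open import Data.List using (List; []; _∷_; map; _++_; length; filter; cartesianProduct)
open import Data.List.Relation.Unary.All using (All; []; _∷_)
open import Data.List.Relation.Unary.Any using () renaming (here to hereₗ)
open import Data.List.Relation.Unary.Unique.Propositional using (Unique)
import Data.List.Relation.Unary.Unique.Propositional.Properties as Unique
import Data.List.Relation.Unary.AllPairs as AllPairs
open import Data.List.Membership.Propositional renaming (_∈_ to _∈ₗ_)
open import Data.List.Membership.Propositional.Properties
open import Function.Bundles using (_⇔_; mk⇔; Equivalence)
open import Relation.Nullary using (yes; no; ¬_)
open import Relation.Binary.PropositionalEquality

open +-*-Solver using (solve; _:+_; _:*_; _:=_; con)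
open ≡-Reasoning

interchange : ∀ a b c e → (a + b) + (c + e) ≡ (a + c) + (b + e)
interchange = solve 4 (λ a b c e → (a :+ b) :+ (c :+ e) := (a :+ c) :+ (b :+ e)) refl

*-left-comm : ∀ a b c → a * (b * c) ≡ b * (a * c)
*-left-comm = solve 3 (λ a b c → a :* (b :* c) := b :* (a :* c)) refl

Series : Set
Series = ℕ → ℕ

infixl 7 _⋆_
_⋆_ : Series → Series → Series
(f ⋆ g) zero    = f 0 * g 0
(f ⋆ g) (suc d) = f 0 * g (suc d) + ((λ i → f (suc i)) ⋆ g) d

X : Series → Series
X f zero    = 0
X f (suc d) = f d

one : Series
one zero    = 1
one (suc _) = 0

infixl 6 _⊕_
_⊕_ : Series → Series → Series
(f ⊕ g) d = f d + g d

infixr 8 _·_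
_·_ : ℕ → Series → Series
(c · f) d = c * f d

X-cong : ∀ {f g} → (∀ e → f e ≡ g e) → ∀ d → X f d ≡ X g d
X-cong eq zero    = refl
X-cong eq (suc d) = eq d

X-zero : ∀ d → X (λ _ → 0) d ≡ 0
X-zero zero    = refl
X-zero (suc d) = refl

X-⊕ : ∀ f g d → X (f ⊕ g) d ≡ X f d + X g d
X-⊕ f g zero    = refl
X-⊕ f g (suc d) = refl

⋆-cong : ∀ d {f f′ g g′} → (∀ i → i ≤ d → f i ≡ f′ i) → (∀ i → i ≤ d → g i ≡ g′ i) →
         (f ⋆ g) d ≡ (f′ ⋆ g′) d
⋆-cong zero    ef eg = cong₂ _*_ (ef 0 z≤n) (eg 0 z≤n)
⋆-cong (suc d) ef eg = cong₂ _+_ (cong₂ _*_ (ef 0 z≤n) (eg (suc d) ≤-refl))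
  (⋆-cong d (λ i i≤d → ef (suc i) (s≤s i≤d)) (λ i i≤d → eg i (m≤n⇒m≤1+n i≤d)))

⋆-congˡ : ∀ d {f f′} g → (∀ i → f i ≡ f′ i) → (f ⋆ g) d ≡ (f′ ⋆ g) d
⋆-congˡ d g ef = ⋆-cong d (λ i _ → ef i) (λ _ _ → refl)

⋆-congʳ : ∀ d f {g g′} → (∀ i → g i ≡ g′ i) → (f ⋆ g) d ≡ (f ⋆ g′) d
⋆-congʳ d f eg = ⋆-cong d (λ _ _ → refl) (λ i _ → eg i)

⋆-distribʳ : ∀ d f h g → ((f ⊕ h) ⋆ g) d ≡ (f ⋆ g) d + (h ⋆ g) d
⋆-distribʳ zero    f h g = *-distribʳ-+ (g 0) (f 0) (h 0)
⋆-distribʳ (suc d) f h g =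
  trans (cong₂ _+_ (*-distribʳ-+ (g (suc d)) (f 0) (h 0)) (⋆-distribʳ d (λ i → f (suc i)) (λ i → h (suc i)) g))
        (interchange (f 0 * g (suc d)) (h 0 * g (suc d)) _ _)

⋆-distribˡ : ∀ d f g h → (f ⋆ (g ⊕ h)) d ≡ (f ⋆ g) d + (f ⋆ h) d
⋆-distribˡ zero    f g h = *-distribˡ-+ (f 0) (g 0) (h 0)
⋆-distribˡ (suc d) f g h =
  trans (cong₂ _+_ (*-distribˡ-+ (f 0) (g (suc d)) (h (suc d))) (⋆-distribˡ d (λ i → f (suc i)) g h))
        (interchange (f 0 * g (suc d)) (f 0 * h (suc d)) _ _)

⋆-scaleˡ : ∀ d c f g → ((c · f) ⋆ g) d ≡ c * (f ⋆ g) d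
⋆-scaleˡ zero    c f g = *-assoc c (f 0) (g 0)
⋆-scaleˡ (suc d) c f g =
  trans (cong₂ _+_ (*-assoc c (f 0) (g (suc d))) (⋆-scaleˡ d c (λ i → f (suc i)) g)) (sym (*-distribˡ-+ c _ _))

⋆-scaleʳ : ∀ d c f g → (f ⋆ (c · g)) d ≡ c * (f ⋆ g) d
⋆-scaleʳ zero    c f g = *-left-comm (f 0) c (g 0)
⋆-scaleʳ (suc d) c f g =
  trans (cong₂ _+_ (*-left-comm (f 0) c (g (suc d))) (⋆-scaleʳ d c (λ i → f (suc i)) g)) (sym (*-distribˡ-+ c _ _))

⋆-Xˡ : ∀ d f g → (X f ⋆ g) d ≡ X (f ⋆ g) d
⋆-Xˡ zero    f g = refl
⋆-Xˡ (suc d) f g = refl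

⋆-Xʳ : ∀ d f g → (f ⋆ X g) (suc d) ≡ (f ⋆ g) d
⋆-Xʳ zero    f g = trans (cong (f 0 * g 0 +_) (*-zeroʳ (f 1))) (+-identityʳ _)
⋆-Xʳ (suc d) f g = cong (f 0 * g (suc d) +_) (⋆-Xʳ d (λ i → f (suc i)) g)

⋆-zeroʳ : ∀ d f → (f ⋆ (λ _ → 0)) d ≡ 0
⋆-zeroʳ zero    f = *-zeroʳ (f 0)
⋆-zeroʳ (suc d) f = trans (cong (_+ ((λ i → f (suc i)) ⋆ (λ _ → 0)) d) (*-zeroʳ (f 0))) (⋆-zeroʳ d (λ i → f (suc i)))

⋆-zeroˡ : ∀ d g → ((λ _ → 0) ⋆ g) d ≡ 0
⋆-zeroˡ zero    g = refl
⋆-zeroˡ (suc d) g = ⋆-zeroˡ d g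

⋆-identityˡ : ∀ d g → (one ⋆ g) d ≡ g d
⋆-identityˡ zero    g = +-identityʳ (g 0)
⋆-identityˡ (suc d) g = trans (cong₂ _+_ (+-identityʳ (g (suc d))) (⋆-zeroˡ d g)) (+-identityʳ _)

⋆-identityʳ : ∀ d f → (f ⋆ one) d ≡ f d
⋆-identityʳ zero    f = *-identityʳ (f 0)
⋆-identityʳ (suc d) f = trans (cong (_+ ((λ i → f (suc i)) ⋆ one) d) (*-zeroʳ (f 0))) (⋆-identityʳ d (λ i → f (suc i)))

⋆-assoc : ∀ d f g h → ((f ⋆ g) ⋆ h) d ≡ (f ⋆ (g ⋆ h)) d
⋆-assoc zero    f g h = *-assoc (f 0) (g 0) (h 0)
⋆-assoc (suc d) f g h = begin
  f0g0 * h (suc d) + (((λ i → f 0 * g (suc i)) ⊕ (f′ ⋆ g)) ⋆ h) d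
    ≡⟨ cong (f0g0 * h (suc d) +_) (⋆-distribʳ d (λ i → f 0 * g (suc i)) (f′ ⋆ g) h) ⟩
  f0g0 * h (suc d) + (((f 0 · g′) ⋆ h) d + ((f′ ⋆ g) ⋆ h) d)
    ≡⟨ cong₂ (λ x y → f0g0 * h (suc d) + (x + y)) (⋆-scaleˡ d (f 0) g′ h) (⋆-assoc d f′ g h) ⟩
  f0g0 * h (suc d) + (f 0 * (g′ ⋆ h) d + (f′ ⋆ (g ⋆ h)) d)
    ≡⟨ solve 5 (λ a b c e r → (a :* b) :* c :+ (a :* e :+ r) := a :* (b :* c :+ e) :+ r) refl
             (f 0) (g 0) (h (suc d)) ((g′ ⋆ h) d) ((f′ ⋆ (g ⋆ h)) d) ⟩
  f 0 * (g 0 * h (suc d) + (g′ ⋆ h) d) + (f′ ⋆ (g ⋆ h)) d ∎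
  where
    f0g0 = f 0 * g 0
    f′ g′ : Series
    f′ i = f (suc i)
    g′ i = g (suc i)

sumBelow : ℕ → (ℕ → ℕ) → ℕ
sumBelow zero    f = 0
sumBelow (suc n) f = sumBelow n f + f n

sumBelow-cong : ∀ n {f g} → (∀ u → u < n → f u ≡ g u) → sumBelow n f ≡ sumBelow n g
sumBelow-cong zero    e = refl
sumBelow-cong (suc n) e = cong₂ _+_ (sumBelow-cong n (λ u u<n → e u (m<n⇒m<1+n u<n))) (e n ≤-refl)

sumBelow-+ : ∀ n f g → sumBelow n (λ u → f u + g u) ≡ sumBelow n f + sumBelow n g
sumBelow-+ zero    f g = refl
sumBelow-+ (suc n) f g =
  trans (cong (_+ (f n + g n)) (sumBelow-+ n f g)) (interchange (sumBelow n f) (sumBelow n g) (f n) (g n))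

sumBelow-const : ∀ n c → sumBelow n (λ _ → c) ≡ n * c
sumBelow-const zero    c = refl
sumBelow-const (suc n) c = trans (cong (_+ c) (sumBelow-const n c)) (+-comm (n * c) c)

sumBelow-X : ∀ n (F : ℕ → Series) d → sumBelow n (λ u → X (F u) d) ≡ X (λ e → sumBelow n (λ u → F u e)) d
sumBelow-X n       F (suc d) = refl
sumBelow-X zero    F zero    = refl
sumBelow-X (suc n) F zero    = trans (+-identityʳ _) (sumBelow-X n F zero)

𝟙[_≤_] : ℕ → ℕ → ℕ
𝟙[ m ≤ n ] with m ≤? n
... | yes _ = 1
... | no  _ = 0

𝟙-yes : ∀ {m n} → m ≤ n → 𝟙[ m ≤ n ] ≡ 1
𝟙-yes {m} {n} m≤n with m ≤? n
... | yes _  = refl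
... | no m≰n = ⊥-elim (m≰n m≤n)

𝟙-no : ∀ {m n} → n < m → 𝟙[ m ≤ n ] ≡ 0
𝟙-no {m} {n} n<m with m ≤? n
... | yes m≤n = ⊥-elim (<⇒≱ n<m m≤n)
... | no  _   = refl

sumBelow-restrict : ∀ n a F → a ≤ n → sumBelow n (λ u → 𝟙[ suc u ≤ a ] * F u) ≡ sumBelow a F
sumBelow-restrict zero    .zero F z≤n = refl
sumBelow-restrict (suc n) a     F a≤1+n with a ≤? n
... | yes a≤n = begin
  sumBelow n (λ u → 𝟙[ suc u ≤ a ] * F u) + 𝟙[ suc n ≤ a ] * F n
    ≡⟨ cong (λ x → sumBelow n (λ u → 𝟙[ suc u ≤ a ] * F u) + x * F n) (𝟙-no (s≤s a≤n)) ⟩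
  sumBelow n (λ u → 𝟙[ suc u ≤ a ] * F u) + 0
    ≡⟨ trans (+-identityʳ _) (sumBelow-restrict n a F a≤n) ⟩
  sumBelow a F ∎
... | no a≰n with ≤-antisym a≤1+n (≰⇒> a≰n)
...   | refl = sumBelow-cong (suc n) (λ u u<a → trans (cong (_* F u) (𝟙-yes u<a)) (+-identityʳ (F u)))

∑ : {A : Set} → (A → ℕ) → List A → ℕ
∑ f xs = sum (map f xs)

∑-cong : {A : Set} {f g : A → ℕ} → (∀ x → f x ≡ g x) → ∀ xs → ∑ f xs ≡ ∑ g xs
∑-cong e []       = refl
∑-cong e (x ∷ xs) = cong₂ _+_ (e x) (∑-cong e xs)

∑-++ : {A : Set} (f : A → ℕ) (xs ys : List A) → ∑ f (xs ++ ys) ≡ ∑ f xs + ∑ f ys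
∑-++ f xs ys = trans (cong sum (map-++ f xs ys)) (sum-++ (map f xs) (map f ys))

∑-map : {A B : Set} (f : B → ℕ) (h : A → B) (xs : List A) → ∑ f (map h xs) ≡ ∑ (λ x → f (h x)) xs
∑-map f h xs = cong sum (sym (map-∘ xs))

∑-cartesianProduct : {A B : Set} (f : A × B → ℕ) (xs : List A) (ys : List B) →
  ∑ f (cartesianProduct xs ys) ≡ ∑ (λ x → ∑ (λ y → f (x , y)) ys) xs
∑-cartesianProduct f []       ys = refl
∑-cartesianProduct f (x ∷ xs) ys =
  trans (∑-++ f (map (x ,_) ys) (cartesianProduct xs ys))
        (cong₂ _+_ (∑-map f (x ,_) ys) (∑-cartesianProduct f xs ys))

∑-⋆ˡ : {A : Set} (φ : A → Series) (g : Series) (d : ℕ) (xs : List A) →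
  ∑ (λ x → (φ x ⋆ g) d) xs ≡ ((λ i → ∑ (λ x → φ x i) xs) ⋆ g) d
∑-⋆ˡ φ g d []       = sym (⋆-zeroˡ d g)
∑-⋆ˡ φ g d (x ∷ xs) = trans (cong ((φ x ⋆ g) d +_) (∑-⋆ˡ φ g d xs)) (sym (⋆-distribʳ d (φ x) _ g))

∑-⋆ʳ : {A : Set} (f : Series) (ψ : A → Series) (d : ℕ) (ys : List A) →
  ∑ (λ y → (f ⋆ ψ y) d) ys ≡ (f ⋆ (λ i → ∑ (λ y → ψ y i) ys)) d
∑-⋆ʳ f ψ d []       = sym (⋆-zeroʳ d f)
∑-⋆ʳ f ψ d (y ∷ ys) = trans (cong ((f ⋆ ψ y) d +_) (∑-⋆ʳ f ψ d ys)) (sym (⋆-distribˡ d f (ψ y) _))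

∑∑-⋆ : {A B : Set} (φ : A → Series) (ψ : B → Series) (d : ℕ) (xs : List A) (ys : List B) →
  ∑ (λ x → ∑ (λ y → (φ x ⋆ ψ y) d) ys) xs ≡ ((λ i → ∑ (λ x → φ x i) xs) ⋆ (λ i → ∑ (λ y → ψ y i) ys)) d
∑∑-⋆ φ ψ d xs ys = trans (∑-cong (λ x → ∑-⋆ʳ (φ x) ψ d ys) xs) (∑-⋆ˡ φ _ d xs)

0C-suc : ∀ k → 0 C suc k ≡ 0
0C-suc k = k>n⇒nCk≡0 {n = 0} {k = suc k} (s≤s z≤n)

nC0≡1 : ∀ n → n C 0 ≡ 1
nC0≡1 n = trans (nCk≡nC[n∸k] {k = 0} {n = n} z≤n) (nCn≡1 n)

-- Pascal's rule for a truncated upper index (both sides vanish when q > m).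
pascal-∸ : ∀ m q k → (suc m ∸ q) C suc (suc k) ≡ (m ∸ q) C suc (suc k) + (m ∸ q) C suc k
pascal-∸ m q k with q ≤? m
... | yes q≤m = begin
  (suc m ∸ q) C suc (suc k)                 ≡⟨ cong (_C suc (suc k)) (+-∸-assoc 1 q≤m) ⟩
  suc (m ∸ q) C suc (suc k)                 ≡⟨ sym (nCk+nC[k+1]≡[n+1]C[k+1] (m ∸ q) (suc k)) ⟩
  (m ∸ q) C suc k + (m ∸ q) C suc (suc k)   ≡⟨ +-comm ((m ∸ q) C suc k) _ ⟩
  (m ∸ q) C suc (suc k) + (m ∸ q) C suc k   ∎
... | no q≰m = begin
  (suc m ∸ q) C suc (suc k)                 ≡⟨ cong (_C suc (suc k)) (m≤n⇒m∸n≡0 m<q) ⟩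
  0 C suc (suc k)                           ≡⟨ 0C-suc (suc k) ⟩
  0                                         ≡⟨ sym (cong₂ _+_ (0C-suc (suc k)) (0C-suc k)) ⟩
  0 C suc (suc k) + 0 C suc k               ≡⟨ sym (cong (λ x → x C suc (suc k) + x C suc k) (m≤n⇒m∸n≡0 (<⇒≤ m<q))) ⟩
  (m ∸ q) C suc (suc k) + (m ∸ q) C suc k   ∎
  where m<q = ≰⇒> q≰m

positive-≤∸ : ∀ x y m → 1 ≤ x → x ≤ m ∸ y → x + y ≤ m
positive-≤∸ x y m 1≤x x≤m∸y with y ≤? m
... | yes y≤m = m≤o∸n⇒m+n≤o x y≤m x≤m∸y
... | no  y≰m with () ← ≤-trans 1≤x (≤-trans x≤m∸y (≤-reflexive (m≤n⇒m∸n≡0 (<⇒≤ (≰⇒> y≰m)))))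

mono : ℕ → Series
mono zero    = one
mono (suc a) = X (mono a)

mono-⋆ : ∀ a b j → (mono a ⋆ mono b) j ≡ mono (a + b) j
mono-⋆ zero    b j = ⋆-identityˡ j (mono b)
mono-⋆ (suc a) b j = trans (⋆-Xˡ j (mono a) (mono b)) (X-cong (mono-⋆ a b) j)

⟦_⟧ : Bool → ℕ
⟦ true  ⟧ = 1
⟦ false ⟧ = 0

⟦∧⟧ : ∀ x y → ⟦ x ∧ y ⟧ ≡ ⟦ x ⟧ * ⟦ y ⟧
⟦∧⟧ true  y = sym (+-identityʳ ⟦ y ⟧)
⟦∧⟧ false y = refl

weighted-mono-⋆ : ∀ x y a b j → ⟦ x ∧ y ⟧ * mono (a + b) j ≡ ((⟦ x ⟧ · mono a) ⋆ (⟦ y ⟧ · mono b)) j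
weighted-mono-⋆ x y a b j = sym (begin
  ((⟦ x ⟧ · mono a) ⋆ (⟦ y ⟧ · mono b)) j   ≡⟨ ⋆-scaleˡ j ⟦ x ⟧ (mono a) _ ⟩
  ⟦ x ⟧ * (mono a ⋆ (⟦ y ⟧ · mono b)) j     ≡⟨ cong (⟦ x ⟧ *_) (⋆-scaleʳ j ⟦ y ⟧ (mono a) (mono b)) ⟩
  ⟦ x ⟧ * (⟦ y ⟧ * (mono a ⋆ mono b) j)     ≡⟨ cong (λ z → ⟦ x ⟧ * (⟦ y ⟧ * z)) (mono-⋆ a b j) ⟩
  ⟦ x ⟧ * (⟦ y ⟧ * mono (a + b) j)          ≡⟨ *-assoc ⟦ x ⟧ ⟦ y ⟧ _ ⟨
  ⟦ x ⟧ * ⟦ y ⟧ * mono (a + b) j            ≡⟨ cong (_* mono (a + b) j) (⟦∧⟧ x y) ⟨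
  ⟦ x ∧ y ⟧ * mono (a + b) j                ∎)

mono-≡ᵇ : ∀ a k → ⟦ a ≡ᵇ k ⟧ ≡ mono a k
mono-≡ᵇ zero    zero    = refl
mono-≡ᵇ zero    (suc k) = refl
mono-≡ᵇ (suc a) zero    = refl
mono-≡ᵇ (suc a) (suc k) = mono-≡ᵇ a k

∑-zero : {A : Set} (xs : List A) → ∑ (λ _ → 0) xs ≡ 0
∑-zero []       = refl
∑-zero (x ∷ xs) = ∑-zero xs

∑-X : {A : Set} (w : A → ℕ) (f : A → Series) (xs : List A) (d : ℕ) →
      ∑ (λ x → w x * X (f x) d) xs ≡ X (λ e → ∑ (λ x → w x * f x e) xs) d
∑-X w f xs zero    = trans (∑-cong (λ x → *-zeroʳ (w x)) xs) (∑-zero xs)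
∑-X w f xs (suc d) = refl

length-filter : {A : Set} (b : A → Bool) (xs : List A) → length (filter (λ x → b x ≟B true) xs) ≡ ∑ (λ x → ⟦ b x ⟧) xs
length-filter b []       = refl
length-filter b (x ∷ xs) with b x
... | true  = cong suc (length-filter b xs)
... | false = length-filter b xs

allSubsets : ∀ n → List (Subset n)
allSubsets zero    = [] ∷ []
allSubsets (suc n) = map (false ∷_) (allSubsets n) ++ map (true ∷_) (allSubsets n)

allSubsets-complete : ∀ {n} (A : Subset n) → A ∈ₗ allSubsets n
allSubsets-complete []          = hereₗ refl
allSubsets-complete (false ∷ A) = ∈-++⁺ˡ (∈-map⁺ (false ∷_) (allSubsets-complete A))
allSubsets-complete {suc n} (true ∷ A) =
  ∈-++⁺ʳ (map (false ∷_) (allSubsets n)) (∈-map⁺ (true ∷_) (allSubsets-complete A))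

allSubsets-unique : ∀ n → Unique (allSubsets n)
allSubsets-unique zero    = [] AllPairs.∷ AllPairs.[]
allSubsets-unique (suc n) =
  Unique.++⁺ (Unique.map⁺ ∷-injectiveʳ (allSubsets-unique n)) (Unique.map⁺ ∷-injectiveʳ (allSubsets-unique n)) disjoint
  where
    ∷-injectiveʳ : ∀ {b} {A B : Subset n} → b ∷ A ≡ b ∷ B → A ≡ B
    ∷-injectiveʳ refl = refl
    disjoint : ∀ {v} → ¬ (v ∈ₗ map (false ∷_) (allSubsets n) × v ∈ₗ map (true ∷_) (allSubsets n))
    disjoint (p , q) with ∈-map⁻ (false ∷_) p | ∈-map⁻ (true ∷_) q
    ... | _ , _ , refl | _ , _ , ()

∑-allSubsets-suc : ∀ n (f : Subset (suc n) → ℕ) →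
  ∑ f (allSubsets (suc n)) ≡ ∑ (λ A → f (false ∷ A)) (allSubsets n) + ∑ (λ A → f (true ∷ A)) (allSubsets n)
∑-allSubsets-suc n f = trans (∑-++ f (map (false ∷_) (allSubsets n)) (map (true ∷_) (allSubsets n)))
                             (cong₂ _+_ (∑-map f (false ∷_) (allSubsets n)) (∑-map f (true ∷_) (allSubsets n)))

allFamilies : ∀ ms → List (Family ms)
allFamilies []       = tt ∷ []
allFamilies (m ∷ ms) = cartesianProduct (allSubsets m) (allFamilies ms)

allFamilies-complete : ∀ ms (F : Family ms) → F ∈ₗ allFamilies ms
allFamilies-complete []       tt      = hereₗ refl
allFamilies-complete (m ∷ ms) (A , F) = ∈-cartesianProduct⁺ (allSubsets-complete A) (allFamilies-complete ms F)

allFamilies-unique : ∀ ms → Unique (allFamilies ms)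
allFamilies-unique []       = [] AllPairs.∷ AllPairs.[]
allFamilies-unique (m ∷ ms) = Unique.cartesianProduct⁺ (allSubsets-unique m) (allFamilies-unique ms)

GF : {A : Set} → (A → Bool) → (A → ℕ) → List A → Series
GF b size xs i = ∑ (λ x → ⟦ b x ⟧ * mono (size x) i) xs

GF-product : {A B : Set} (b : A → Bool) (c : B → Bool) (sa : A → ℕ) (sb : B → ℕ) (xs : List A) (ys : List B) →
  ∀ j → GF (λ p → b (proj₁ p) ∧ c (proj₂ p)) (λ p → sa (proj₁ p) + sb (proj₂ p)) (cartesianProduct xs ys) j
        ≡ (GF b sa xs ⋆ GF c sb ys) j
GF-product b c sa sb xs ys j = begin
  ∑ (λ p → ⟦ b (proj₁ p) ∧ c (proj₂ p) ⟧ * mono (sa (proj₁ p) + sb (proj₂ p)) j) (cartesianProduct xs ys)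
    ≡⟨ ∑-cartesianProduct _ xs ys ⟩
  ∑ (λ x → ∑ (λ y → ⟦ b x ∧ c y ⟧ * mono (sa x + sb y) j) ys) xs
    ≡⟨ ∑-cong (λ x → ∑-cong (λ y → weighted-mono-⋆ (b x) (c y) (sa x) (sb y) j) ys) xs ⟩
  ∑ (λ x → ∑ (λ y → ((⟦ b x ⟧ · mono (sa x)) ⋆ (⟦ c y ⟧ · mono (sb y))) j) ys) xs
    ≡⟨ ∑∑-⋆ (λ x → ⟦ b x ⟧ · mono (sa x)) (λ y → ⟦ c y ⟧ · mono (sb y)) j xs ys ⟩
  (GF b sa xs ⋆ GF c sb ys) j ∎

hasCard-by-test : ∀ {ms} (P : Family ms → Set) (b : Family ms → Bool) → (∀ F → b F ≡ true ⇔ P F) →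
                  HasCard P (∑ (λ F → ⟦ b F ⟧) (allFamilies ms))
hasCard-by-test {ms} P b b⇔P =
  filter test (allFamilies ms) , Unique.filter⁺ test (allFamilies-unique ms) , members , length-filter b (allFamilies ms)
  where
    test = λ F → b F ≟B true
    members : ∀ F → (F ∈ₗ filter test (allFamilies ms)) ⇔ P F
    members F = mk⇔ (λ F∈ → Equivalence.to (b⇔P F) (proj₂ (∈-filter⁻ test {xs = allFamilies ms} F∈)))
                    (λ PF → ∈-filter⁺ test (allFamilies-complete ms F) (Equivalence.from (b⇔P F) PF))

module _ (s : ℕ) where

  -- path m: coefficient d is C(m - s(d-1), d), the number of s-separated
  -- d-subsets of a path of m cells (established in `window-count` below).
  path : ℕ → Series
  path m zero    = 1
  path m (suc d) = (m ∸ s * d) C suc d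

  path-0 : ∀ d → path 0 d ≡ one d
  path-0 zero    = refl
  path-0 (suc d) = trans (cong (_C suc d) (0∸n≡0 (s * d))) (0C-suc d)

  ⋆-path-0ˡ : ∀ d g → (path 0 ⋆ g) d ≡ g d
  ⋆-path-0ˡ d g = trans (⋆-congˡ d g path-0) (⋆-identityˡ d g)

  -- The basic recurrence: the last cell is either empty or used, and using
  -- it forbids the s cells before it.
  path-suc : ∀ m d → path (suc m) d ≡ path m d + X (path (m ∸ s)) d
  path-suc m zero          = refl
  path-suc m (suc zero)    = begin
    (suc m ∸ s * 0) C 1     ≡⟨ cong (λ x → (suc m ∸ x) C 1) (*-zeroʳ s) ⟩
    suc m C 1               ≡⟨ nC1≡n (suc m) ⟩
    suc m                   ≡⟨ +-comm 1 m ⟩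
    m + 1                   ≡⟨ cong (_+ 1) (nC1≡n m) ⟨
    m C 1 + 1               ≡⟨ cong (λ x → (m ∸ x) C 1 + 1) (*-zeroʳ s) ⟨
    (m ∸ s * 0) C 1 + 1     ∎
  path-suc m (suc (suc e)) = begin
    (suc m ∸ s * suc e) C suc (suc e)
      ≡⟨ pascal-∸ m (s * suc e) e ⟩
    (m ∸ s * suc e) C suc (suc e) + (m ∸ s * suc e) C suc e
      ≡⟨ cong (λ x → (m ∸ s * suc e) C suc (suc e) + (m ∸ x) C suc e) (*-suc s e) ⟩
    (m ∸ s * suc e) C suc (suc e) + (m ∸ (s + s * e)) C suc e
      ≡⟨ cong (λ x → (m ∸ s * suc e) C suc (suc e) + x C suc e) (∸-+-assoc m s (s * e)) ⟨
    (m ∸ s * suc e) C suc (suc e) + ((m ∸ s) ∸ s * e) C suc e ∎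

  -- Iterating path-suc over the last a cells: classify by the last element
  -- among them.
  path-unroll : ∀ c a d → path (c + a) d ≡ path c d + X (λ e → sumBelow a (λ u → path ((c + u) ∸ s) e)) d
  path-unroll c zero    d =
    trans (cong (λ z → path z d) (+-identityʳ c)) (sym (trans (cong (path c d +_) (X-zero d)) (+-identityʳ _)))
  path-unroll c (suc a) d = begin
    path (c + suc a) d                              ≡⟨ cong (λ z → path z d) (+-suc c a) ⟩
    path (suc (c + a)) d                            ≡⟨ path-suc (c + a) d ⟩
    path (c + a) d + X (path ((c + a) ∸ s)) d       ≡⟨ cong (_+ X (path ((c + a) ∸ s)) d) (path-unroll c a d) ⟩
    path c d + X (terms a) d + X (path ((c + a) ∸ s)) d
                                                    ≡⟨ +-assoc (path c d) _ _ ⟩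
    path c d + (X (terms a) d + X (path ((c + a) ∸ s)) d)
                                                    ≡⟨ cong (path c d +_) (X-⊕ (terms a) (path ((c + a) ∸ s)) d) ⟨
    path c d + X (terms (suc a)) d                  ∎
    where
      terms : ℕ → Series
      terms a e = sumBelow a (λ u → path ((c + u) ∸ s) e)

  bound-pred : ∀ e x → s * suc e ≤ x + s → s * e ≤ x
  bound-pred e x h = +-cancelʳ-≤ s (s * e) x (subst (_≤ x + s) (trans (*-suc s e) (+-comm s (s * e))) h)

  s<s*[2+i] : 1 ≤ s → ∀ i → suc s ≤ s * suc (suc i)
  s<s*[2+i] 1≤s i = subst (_≤ s * suc (suc i)) (+-comm s 1)
    (subst (s + 1 ≤_) (sym (*-suc s (suc i))) (+-monoʳ-≤ s (≤-trans 1≤s (m≤m*n s (suc i)))))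

  ShiftsBy1 : ℕ → Set
  ShiftsBy1 d = ∀ a b → s * d ≤ a + s → s * d ≤ b + s →
                (path a ⋆ path (suc b)) d ≡ (path (suc a) ⋆ path b) d

  ShiftsBy : ℕ → Set
  ShiftsBy d = ∀ m a b → s * d ≤ a + s → s * d ≤ b + s →
               (path a ⋆ path (m + b)) d ≡ (path (m + a) ⋆ path b) d

  shifts-iterate : ∀ d → ShiftsBy1 d → ShiftsBy d
  shifts-iterate d sh zero    a b _  _  = refl
  shifts-iterate d sh (suc m) a b ha hb = begin
    (path a ⋆ path (suc (m + b))) d  ≡⟨ sh a (m + b) ha (≤-trans hb (+-monoˡ-≤ s (m≤n+m b m))) ⟩
    (path (suc a) ⋆ path (m + b)) d  ≡⟨ shifts-iterate d sh m (suc a) b (≤-trans ha (+-monoˡ-≤ s (n≤1+n a))) hb ⟩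
    (path (m + suc a) ⋆ path b) d    ≡⟨ cong (λ z → (path z ⋆ path b) d) (+-suc m a) ⟩
    (path (suc m + a) ⋆ path b) d    ∎

  -- The inductive step in the degree: expanding path (suc b) and path (suc a)
  -- by path-suc, the two sides differ only in X(path a ⋆ path (b ∸ s)) versus
  -- X(path (a ∸ s) ⋆ path b).
  shift-step : ∀ e a b → (path a ⋆ path (b ∸ s)) e ≡ (path (a ∸ s) ⋆ path b) e →
               (path a ⋆ path (suc b)) (suc e) ≡ (path (suc a) ⋆ path b) (suc e)
  shift-step e a b lower = begin
    (path a ⋆ path (suc b)) (suc e)
      ≡⟨ ⋆-congʳ (suc e) (path a) (path-suc b) ⟩
    (path a ⋆ (path b ⊕ X (path (b ∸ s)))) (suc e)
      ≡⟨ ⋆-distribˡ (suc e) (path a) (path b) (X (path (b ∸ s))) ⟩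
    (path a ⋆ path b) (suc e) + (path a ⋆ X (path (b ∸ s))) (suc e)
      ≡⟨ cong ((path a ⋆ path b) (suc e) +_) (trans (⋆-Xʳ e (path a) (path (b ∸ s))) lower) ⟩
    (path a ⋆ path b) (suc e) + (X (path (a ∸ s)) ⋆ path b) (suc e)
      ≡⟨ ⋆-distribʳ (suc e) (path a) (X (path (a ∸ s))) (path b) ⟨
    ((path a ⊕ X (path (a ∸ s))) ⋆ path b) (suc e)
      ≡⟨ ⋆-congˡ (suc e) (path b) (path-suc a) ⟨
    (path (suc a) ⋆ path b) (suc e) ∎

  shift₁   : ∀ d → ShiftsBy1 d
  shift-down : ∀ e a b → s * e ≤ a → s * e ≤ b →
               (path a ⋆ path (b ∸ s)) e ≡ (path (a ∸ s) ⋆ path b) e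

  shift₁ zero    a b _  _  = refl
  shift₁ (suc e) a b ha hb = shift-step e a b (shift-down e a b (bound-pred e a ha) (bound-pred e b hb))

  -- The hypothesis of shift-step: for e ≥ 1 both paths have at least s cells,
  -- and it is the shift by s cells in degree e.
  shift-down zero    a b _  _  = refl
  shift-down (suc e) a b ha hb = begin
    (path a ⋆ path (b ∸ s)) (suc e)
      ≡⟨ cong (λ z → (path z ⋆ path (b ∸ s)) (suc e)) (m+[n∸m]≡n s≤a) ⟨
    (path (s + (a ∸ s)) ⋆ path (b ∸ s)) (suc e)
      ≡⟨ shifts-iterate (suc e) (shift₁ (suc e)) s (a ∸ s) (b ∸ s) (restore ha) (restore hb) ⟨
    (path (a ∸ s) ⋆ path (s + (b ∸ s))) (suc e)
      ≡⟨ cong (λ z → (path (a ∸ s) ⋆ path z) (suc e)) (m+[n∸m]≡n s≤b) ⟩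
    (path (a ∸ s) ⋆ path b) (suc e) ∎
    where
      s≤a = ≤-trans (m≤m*n s (suc e)) ha
      s≤b = ≤-trans (m≤m*n s (suc e)) hb
      restore : ∀ {x} → s * suc e ≤ x → s * suc e ≤ (x ∸ s) + s
      restore h = subst (s * suc e ≤_) (sym (m∸n+n≡m (≤-trans (m≤m*n s (suc e)) h))) h

  shift : ∀ d → ShiftsBy d
  shift d = shifts-iterate d (shift₁ d)

  -- In a path of a + s + c cells the s cells after the
  -- first a form a window holding at most one element.  Without one, the set
  -- splits into subsets of the outer paths of a and c cells; with one, at
  -- window cell u counted from the right, the paths left of it and right of
  -- it shrink to (a + s-1-u) - s and (c + u) - s cells.
  windowTerms : ℕ → ℕ → Series
  windowTerms a c e = sumBelow s (λ u → (path ((a + (s ∸ suc u)) ∸ s) ⋆ path ((c + u) ∸ s)) e)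

  Window : ℕ → ℕ → ℕ → Set
  Window a c d = path (a + s + c) d ≡ (path a ⋆ path c) d + X (windowTerms a c) d

  windowTermsΔ : ℕ → ℕ → Series
  windowTermsΔ a c e =
    sumBelow s (λ u → 𝟙[ s ≤ a + (s ∸ suc u) ] * (path (((a + (s ∸ suc u)) ∸ s) ∸ s) ⋆ path ((c + u) ∸ s)) e)

  path-suc-∸ : ∀ x i → path (suc x ∸ s) i ≡ path (x ∸ s) i + X (𝟙[ s ≤ x ] · path ((x ∸ s) ∸ s)) i
  path-suc-∸ x i with s ≤? x
  ... | yes s≤x = begin
    path (suc x ∸ s) i                              ≡⟨ cong (λ z → path z i) (+-∸-assoc 1 s≤x) ⟩
    path (suc (x ∸ s)) i                            ≡⟨ path-suc (x ∸ s) i ⟩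
    path (x ∸ s) i + X (path ((x ∸ s) ∸ s)) i       ≡⟨ cong (path (x ∸ s) i +_) (X-cong (λ e → sym (*-identityˡ _)) i) ⟩
    path (x ∸ s) i + X (1 · path ((x ∸ s) ∸ s)) i   ∎
  ... | no s≰x = begin
    path (suc x ∸ s) i                              ≡⟨ cong (λ z → path z i) (m≤n⇒m∸n≡0 (≰⇒> s≰x)) ⟩
    path 0 i                                        ≡⟨ +-identityʳ _ ⟨
    path 0 i + 0                                    ≡⟨ cong (path 0 i +_) (X-zero i) ⟨
    path 0 i + X (0 · path ((x ∸ s) ∸ s)) i
      ≡⟨ cong (λ z → path z i + X (0 · path (z ∸ s)) i) (m≤n⇒m∸n≡0 (<⇒≤ (≰⇒> s≰x))) ⟨
    path (x ∸ s) i + X (0 · path ((x ∸ s) ∸ s)) i   ∎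

  windowTerms-suc : ∀ a c d → windowTerms (suc a) c d ≡ windowTerms a c d + X (windowTermsΔ a c) d
  windowTerms-suc a c d = begin
    windowTerms (suc a) c d
      ≡⟨ sumBelow-cong s (λ u _ → term-suc (a + (s ∸ suc u)) (path ((c + u) ∸ s))) ⟩
    sumBelow s (λ u → (path (t u ∸ s) ⋆ path ((c + u) ∸ s)) d + X (Δ u) d)
      ≡⟨ sumBelow-+ s _ _ ⟩
    windowTerms a c d + sumBelow s (λ u → X (Δ u) d)
      ≡⟨ cong (windowTerms a c d +_) (sumBelow-X s Δ d) ⟩
    windowTerms a c d + X (windowTermsΔ a c) d ∎
    where
      t : ℕ → ℕ
      t u = a + (s ∸ suc u)
      Δ : ℕ → Series
      Δ u e = 𝟙[ s ≤ t u ] * (path ((t u ∸ s) ∸ s) ⋆ path ((c + u) ∸ s)) e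
      term-suc : ∀ x g → (path (suc x ∸ s) ⋆ g) d
                         ≡ (path (x ∸ s) ⋆ g) d + X (λ e → 𝟙[ s ≤ x ] * (path ((x ∸ s) ∸ s) ⋆ g) e) d
      term-suc x g = begin
        (path (suc x ∸ s) ⋆ g) d
          ≡⟨ ⋆-congˡ d g (path-suc-∸ x) ⟩
        ((path (x ∸ s) ⊕ X (𝟙[ s ≤ x ] · path ((x ∸ s) ∸ s))) ⋆ g) d
          ≡⟨ ⋆-distribʳ d (path (x ∸ s)) _ g ⟩
        (path (x ∸ s) ⋆ g) d + (X (𝟙[ s ≤ x ] · path ((x ∸ s) ∸ s)) ⋆ g) d
          ≡⟨ cong ((path (x ∸ s) ⋆ g) d +_) (trans (⋆-Xˡ d _ g) (X-cong (λ e → ⋆-scaleˡ e 𝟙[ s ≤ x ] _ g) d)) ⟩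
        (path (x ∸ s) ⋆ g) d + X (λ e → 𝟙[ s ≤ x ] * (path ((x ∸ s) ∸ s) ⋆ g) e) d ∎

  window-zero : ∀ c d → Window 0 c d
  window-zero c d = begin
    path (s + c) d                                                  ≡⟨ cong (λ z → path z d) (+-comm s c) ⟩
    path (c + s) d                                                  ≡⟨ path-unroll c s d ⟩
    path c d + X (λ e → sumBelow s (λ u → path ((c + u) ∸ s) e)) d
                                                    ≡⟨ cong₂ _+_ (sym (⋆-path-0ˡ d (path c))) (X-cong term d) ⟩
    (path 0 ⋆ path c) d + X (windowTerms 0 c) d                     ∎
    where
      term : ∀ e → sumBelow s (λ u → path ((c + u) ∸ s) e) ≡ windowTerms 0 c e
      term e = sumBelow-cong s (λ u _ → sym (trans
        (cong (λ z → (path z ⋆ path ((c + u) ∸ s)) e) (m≤n⇒m∸n≡0 (m∸n≤m s (suc u))))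
        (⋆-path-0ˡ e (path ((c + u) ∸ s)))))

  -- The identity obtained by removing s cells on the left of a window
  -- identity; it is what the induction on a needs besides Window a c.
  ShiftedWindow : ℕ → ℕ → ℕ → Set
  ShiftedWindow a c d = path (a + c) d ≡ (path (a ∸ s) ⋆ path c) d + X (windowTermsΔ a c) d

  window-suc : ∀ a c d → (∀ e → Window a c e) → (∀ e → ShiftedWindow a c e) → Window (suc a) c d
  window-suc a c d window-a shifted-a = begin
    path (suc (a + s + c)) d
      ≡⟨ path-suc (a + s + c) d ⟩
    path (a + s + c) d + X (path ((a + s + c) ∸ s)) d
      ≡⟨ cong₂ _+_ (window-a d) (X-cong (λ e → trans (cong (λ z → path z e) drop-window) (shifted-a e)) d) ⟩
    (P₀ + W₀) + X ((path (a ∸ s) ⋆ path c) ⊕ X (windowTermsΔ a c)) d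
      ≡⟨ cong ((P₀ + W₀) +_) (X-⊕ _ _ d) ⟩
    (P₀ + W₀) + (P₁ + W₁)
      ≡⟨ interchange P₀ W₀ P₁ W₁ ⟩
    (P₀ + P₁) + (W₀ + W₁)
      ≡⟨ cong₂ _+_ (sym product-suc) (sym (trans (X-cong (windowTerms-suc a c) d) (X-⊕ _ _ d))) ⟩
    (path (suc a) ⋆ path c) d + X (windowTerms (suc a) c) d ∎
    where
      P₀ = (path a ⋆ path c) d
      P₁ = X (path (a ∸ s) ⋆ path c) d
      W₀ = X (windowTerms a c) d
      W₁ = X (X (windowTermsΔ a c)) d
      drop-window : (a + s + c) ∸ s ≡ a + c
      drop-window = trans (cong (_∸ s) (solve 3 (λ a s c → a :+ s :+ c := (a :+ c) :+ s) refl a s c)) (m+n∸n≡m (a + c) s)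
      product-suc : (path (suc a) ⋆ path c) d ≡ P₀ + P₁
      product-suc = begin
        (path (suc a) ⋆ path c) d                 ≡⟨ ⋆-congˡ d (path c) (path-suc a) ⟩
        ((path a ⊕ X (path (a ∸ s))) ⋆ path c) d  ≡⟨ ⋆-distribʳ d (path a) _ (path c) ⟩
        P₀ + (X (path (a ∸ s)) ⋆ path c) d        ≡⟨ cong (P₀ +_) (⋆-Xˡ d (path (a ∸ s)) (path c)) ⟩
        P₀ + P₁                                   ∎

  shifted-window-large : ∀ o c → (∀ d → Window o c d) → ∀ d → ShiftedWindow (s + o) c d
  shifted-window-large o c window-o d = begin
    path (s + o + c) d                                         ≡⟨ cong (λ z → path (z + c) d) (+-comm s o) ⟩
    path (o + s + c) d                                         ≡⟨ window-o d ⟩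
    (path o ⋆ path c) d + X (windowTerms o c) d
      ≡⟨ cong₂ _+_ (cong (λ z → (path z ⋆ path c) d) (sym (m+n∸m≡n s o)))
                   (X-cong (λ e → sym (sumBelow-cong s (λ u _ → term u e))) d) ⟩
    (path ((s + o) ∸ s) ⋆ path c) d + X (windowTermsΔ (s + o) c) d ∎
    where
      term : ∀ u e → 𝟙[ s ≤ s + o + (s ∸ suc u) ] * (path (((s + o + (s ∸ suc u)) ∸ s) ∸ s) ⋆ path ((c + u) ∸ s)) e
                     ≡ (path ((o + (s ∸ suc u)) ∸ s) ⋆ path ((c + u) ∸ s)) e
      term u e rewrite 𝟙-yes (≤-trans (m≤m+n s o) (m≤m+n (s + o) (s ∸ suc u)))
                     | +-assoc s o (s ∸ suc u) | m+n∸m≡n s (o + (s ∸ suc u)) = +-identityʳ _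

  -- For a < s the left paths in windowTermsΔ a c are empty and only the
  -- terms u < a survive, so the identity is path-unroll.
  shifted-window-small : ∀ a c → a < s → ∀ d → ShiftedWindow a c d
  shifted-window-small a c a<s d = begin
    path (a + c) d
      ≡⟨ cong (λ z → path z d) (+-comm a c) ⟩
    path (c + a) d
      ≡⟨ path-unroll c a d ⟩
    path c d + X (λ e → sumBelow a (λ u → path ((c + u) ∸ s) e)) d
      ≡⟨ cong₂ _+_ left (X-cong (λ e → sym (trans (sumBelow-cong s (λ u u<s → term u u<s e))
                                                  (sumBelow-restrict s a _ (<⇒≤ a<s)))) d) ⟩
    (path (a ∸ s) ⋆ path c) d + X (windowTermsΔ a c) d ∎
    where
      left : path c d ≡ (path (a ∸ s) ⋆ path c) d
      left = sym (trans (cong (λ z → (path z ⋆ path c) d) (m≤n⇒m∸n≡0 (<⇒≤ a<s))) (⋆-path-0ˡ d (path c)))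
      term : ∀ u → u < s → ∀ e →
             𝟙[ s ≤ a + (s ∸ suc u) ] * (path (((a + (s ∸ suc u)) ∸ s) ∸ s) ⋆ path ((c + u) ∸ s)) e
             ≡ 𝟙[ suc u ≤ a ] * path ((c + u) ∸ s) e
      term u u<s e with ≤-<-connex (suc u) a
      ... | inj₁ u<a = begin
        𝟙[ s ≤ t ] * (path ((t ∸ s) ∸ s) ⋆ path ((c + u) ∸ s)) e
          ≡⟨ cong₂ _*_ (𝟙-yes s≤t) (trans (cong (λ z → (path z ⋆ path ((c + u) ∸ s)) e) (m≤n⇒m∸n≡0 t∸s≤s))
                                          (⋆-path-0ˡ e _)) ⟩
        1 * path ((c + u) ∸ s) e
          ≡⟨ cong (_* path ((c + u) ∸ s) e) (𝟙-yes u<a) ⟨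
        𝟙[ suc u ≤ a ] * path ((c + u) ∸ s) e ∎
        where
          t = a + (s ∸ suc u)
          s≤t : s ≤ t
          s≤t = subst (_≤ t) (trans (+-comm (suc u) _) (m∸n+n≡m u<s)) (+-monoˡ-≤ (s ∸ suc u) u<a)
          t∸s≤s : t ∸ s ≤ s
          t∸s≤s = subst (t ∸ s ≤_) (m+n∸n≡m s s) (∸-monoˡ-≤ s (+-mono-≤ (<⇒≤ a<s) (m∸n≤m s (suc u))))
      ... | inj₂ a<1+u =
        trans (cong (_* (path (((a + (s ∸ suc u)) ∸ s) ∸ s) ⋆ path ((c + u) ∸ s)) e) (𝟙-no t<s))
              (cong (_* path ((c + u) ∸ s) e) (sym (𝟙-no a<1+u)))
        where
          t<s : a + (s ∸ suc u) < s
          t<s = subst (a + (s ∸ suc u) <_) (trans (+-comm (suc u) _) (m∸n+n≡m u<s)) (+-monoˡ-< (s ∸ suc u) a<1+u)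

  -- The window identity, by induction on a (strong: the step at a ≥ s uses a - s).
  window : ∀ a c d → Window a c d
  window a = bounded a a ≤-refl
    where
      bounded : ∀ n a → a ≤ n → ∀ c d → Window a c d
      bounded n       zero    _         c d = window-zero c d
      bounded (suc n) (suc a) (s≤s a≤n) c d = window-suc a c d (bounded n a a≤n c) shifted
        where
          shifted : ∀ e → ShiftedWindow a c e
          shifted e with s ≤? a
          ... | no s≰a  = shifted-window-small a c (≰⇒> s≰a) e
          ... | yes s≤a with m≤n⇒∃[o]m+o≡n s≤a
          ...   | o , refl = shifted-window-large o c (bounded n o (≤-trans (m≤n+m o s) a≤n) c) e

  -- In low degree every window term is the same product: by the shift lemma
  -- the s-1-u cells left of the window element and the u cells right of it
  -- can be moved so that the left path has L cells.
  window-term-shift : 1 ≤ s → ∀ d L c u → u < s → s * d ≤ L → s * suc d ≤ c →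
    (path ((L + (s ∸ suc u)) ∸ s) ⋆ path ((c + u) ∸ s)) d ≡ (path L ⋆ path (c ∸ suc s)) d
  window-term-shift _   zero    L c u _   _  _  = refl
  window-term-shift 1≤s (suc d) L c u u<s hL hc
    with m≤n⇒∃[o]m+o≡n (≤-trans (m≤m*n s (suc d)) hL) | m≤n⇒∃[o]m+o≡n s<c
    where
      s<c : suc s ≤ c
      s<c = ≤-trans (s<s*[2+i] 1≤s d) hc
  ... | L₀ , refl | b , refl = begin
    (path ((s + L₀ + t) ∸ s) ⋆ path ((suc s + b + u) ∸ s)) (suc d)
      ≡⟨ cong₂ (λ x y → (path x ⋆ path y) (suc d)) left right ⟩
    (path (L₀ + t) ⋆ path (suc u + b)) (suc d)
      ≡⟨ shift (suc d) (suc u) (L₀ + t) b hA hB ⟩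
    (path (suc u + (L₀ + t)) ⋆ path b) (suc d)
      ≡⟨ cong₂ (λ x y → (path x ⋆ path y) (suc d)) moved (sym (m+n∸m≡n (suc s) b)) ⟩
    (path (s + L₀) ⋆ path ((suc s + b) ∸ suc s)) (suc d) ∎
    where
      t = s ∸ suc u
      left : (s + L₀ + t) ∸ s ≡ L₀ + t
      left = trans (cong (_∸ s) (+-assoc s L₀ t)) (m+n∸m≡n s (L₀ + t))
      right : (suc s + b + u) ∸ s ≡ suc u + b
      right = trans (cong (_∸ s) (solve 3 (λ s b u → con 1 :+ s :+ b :+ u := s :+ (con 1 :+ u :+ b)) refl s b u))
                    (m+n∸m≡n s (suc u + b))
      moved : suc u + (L₀ + t) ≡ s + L₀
      moved = begin
        suc u + (L₀ + t)   ≡⟨ solve 3 (λ u L t → con 1 :+ u :+ (L :+ t) := t :+ (con 1 :+ u) :+ L) refl u L₀ t ⟩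
        t + suc u + L₀     ≡⟨ cong (_+ L₀) (m∸n+n≡m u<s) ⟩
        s + L₀             ∎
      hA : s * suc d ≤ (L₀ + t) + s
      hA = ≤-trans hL (subst (_≤ (L₀ + t) + s) (+-comm L₀ s) (+-monoˡ-≤ s (m≤m+n L₀ t)))
      hB : s * suc d ≤ b + s
      hB = ≤-trans (+-cancelˡ-≤ s (s * suc d) (suc b) (subst (_≤ s + suc b) (*-suc s (suc d))
                                                         (subst (s * suc (suc d) ≤_) (sym (+-suc s b)) hc)))
                   (subst (_≤ b + s) (+-comm b 1) (+-monoʳ-≤ b 1≤s))

  -- cycle n: generating function of the s-separated subsets of a circle of n
  -- cells (see `circle-count`): either the first s cells are empty, leaving a
  -- path of n - s cells, or one of them is used, leaving n - 2s - 1 cells.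
  cycle : ℕ → Series
  cycle n i = path (n ∸ s) i + s * X (path (n ∸ suc (s + s))) i

  -- Merging a path with a circle: in low degree, a path of L cells together
  -- with a circle of n cells has as many separated sets as a path of L + n
  -- cells.  Expanding cycle (s + c), the term with the first s circle cells
  -- empty is the window-free part of path (L + s + c), and the s equal window
  -- terms (window-term-shift) account for the rest.
  merge : 1 ≤ s → ∀ j L n → s * j ≤ L + s → s * suc j ≤ n → (path L ⋆ cycle n) j ≡ path (L + n) j
  merge _   zero    L n _  _  = cong (λ x → 1 * (1 + x)) (*-zeroʳ s)
  merge 1≤s (suc d) L n hL hn with m≤n⇒∃[o]m+o≡n (≤-trans (m≤m*n s (suc (suc d))) hn)
  ... | c , refl = begin
    (path L ⋆ cycle (s + c)) (suc d)
      ≡⟨ ⋆-congʳ (suc d) (path L) (λ i → cong₂ _+_ (cong (λ z → path z i) (m+n∸m≡n s c))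
                                                   (cong (λ z → s * X (path z) i) circle-rest)) ⟩
    (path L ⋆ (path c ⊕ s · X (path (c ∸ suc s)))) (suc d)
      ≡⟨ ⋆-distribˡ (suc d) (path L) (path c) _ ⟩
    (path L ⋆ path c) (suc d) + (path L ⋆ s · X (path (c ∸ suc s))) (suc d)
      ≡⟨ cong ((path L ⋆ path c) (suc d) +_) (trans (⋆-scaleʳ (suc d) s (path L) _)
                                                    (cong (s *_) (⋆-Xʳ d (path L) (path (c ∸ suc s))))) ⟩
    (path L ⋆ path c) (suc d) + s * (path L ⋆ path (c ∸ suc s)) d
      ≡⟨ cong ((path L ⋆ path c) (suc d) +_) (sym (trans (sumBelow-cong s terms) (sumBelow-const s _))) ⟩
    (path L ⋆ path c) (suc d) + windowTerms L c d
      ≡⟨ window L c (suc d) ⟨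
    path (L + s + c) (suc d)
      ≡⟨ cong (λ z → path z (suc d)) (+-assoc L s c) ⟩
    path (L + (s + c)) (suc d) ∎
    where
      circle-rest : (s + c) ∸ suc (s + s) ≡ c ∸ suc s
      circle-rest = trans (cong ((s + c) ∸_) (sym (+-suc s s))) ([m+n]∸[m+o]≡n∸o s c (suc s))
      hc : s * suc d ≤ c
      hc = +-cancelˡ-≤ s (s * suc d) c (subst (_≤ s + c) (*-suc s (suc d)) hn)
      terms : ∀ u → u < s → (path ((L + (s ∸ suc u)) ∸ s) ⋆ path ((c + u) ∸ s)) d ≡ (path L ⋆ path (c ∸ suc s)) d
      terms u u<s = window-term-shift 1≤s d L c u u<s (bound-pred d L hL) hc

  -- A subset A of Fin n is (lo, hi, d)-spread if its elements lie in [lo, hi)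
  -- and distinct elements are at distance between s+1 and d.  Separated
  -- subsets of a path are the (0, n, n)-spread ones, of a circle the
  -- (0, n, n-s-1)-spread ones.
  record Spread {n : ℕ} (lo hi d : ℕ) (A : Subset n) : Set where
    constructor spread
    field
      within : ∀ i → i ∈ A → lo ≤ toℕ i × toℕ i < hi
      apart  : ∀ i j → i ∈ A → j ∈ A → i ≢ j → suc s ≤ ∣ toℕ i - toℕ j ∣ × ∣ toℕ i - toℕ j ∣ ≤ d

  spread-skip⁻ : ∀ {n lo hi d} {A : Subset n} → Spread lo hi d (false ∷ A) → Spread (pred lo) (pred hi) d A
  spread-skip⁻ (spread within apart) = spread
    (λ i i∈ → let (l , h) = within (fsuc i) (there i∈) in pred-mono-≤ l , pred-mono-≤ h)
    (λ i j i∈ j∈ i≢j → apart (fsuc i) (fsuc j) (there i∈) (there j∈) (λ eq → i≢j (Fin.suc-injective eq)))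

  spread-skip⁺ : ∀ {n lo hi d} {A : Subset n} → Spread (pred lo) (pred hi) d A → Spread lo hi d (false ∷ A)
  spread-skip⁺ {lo = lo} {hi} {d} {A} (spread within apart) = spread within′ apart′
    where
      within′ : ∀ i → i ∈ false ∷ A → lo ≤ toℕ i × toℕ i < hi
      within′ (fsuc i) (there i∈) with within i i∈
      ... | l , h = lo-suc lo l , hi-suc hi h
        where
          lo-suc : ∀ lo {x} → pred lo ≤ x → lo ≤ suc x
          lo-suc zero    _ = z≤n
          lo-suc (suc _) l = s≤s l
          hi-suc : ∀ hi {x} → x < pred hi → suc x < hi
          hi-suc (suc _) h = s≤s h
      apart′ : ∀ i j → i ∈ false ∷ A → j ∈ false ∷ A → i ≢ j →
               suc s ≤ ∣ toℕ i - toℕ j ∣ × ∣ toℕ i - toℕ j ∣ ≤ d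
      apart′ (fsuc i) (fsuc j) (there i∈) (there j∈) i≢j = apart i j i∈ j∈ (λ eq → i≢j (cong fsuc eq))

  spread-use⁻ : ∀ {n lo hi d} {A : Subset n} → Spread lo hi d (true ∷ A) →
                lo ≡ 0 × 0 < hi × Spread s (d ⊓ pred hi) d A
  spread-use⁻ {hi = hi} {d} (spread within apart) =
    n≤0⇒n≡0 (proj₁ (within fzero here)) , proj₂ (within fzero here) , spread within′ apart′
    where
      within′ : ∀ i → i ∈ _ → s ≤ toℕ i × toℕ i < d ⊓ pred hi
      within′ i i∈ with apart fzero (fsuc i) here (there i∈) (λ ())
      ... | far , near = s≤s⁻¹ far , ⊓-glb near (pred-mono-≤ (proj₂ (within (fsuc i) (there i∈))))
      apart′ : ∀ i j → i ∈ _ → j ∈ _ → i ≢ j → _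
      apart′ i j i∈ j∈ i≢j = apart (fsuc i) (fsuc j) (there i∈) (there j∈) (λ eq → i≢j (Fin.suc-injective eq))

  spread-use⁺ : ∀ {n h d} {A : Subset n} → Spread s (d ⊓ h) d A → Spread 0 (suc h) d (true ∷ A)
  spread-use⁺ {h = h} {d} {A} (spread within apart) = spread within′ apart′
    where
      within′ : ∀ i → i ∈ true ∷ A → 0 ≤ toℕ i × toℕ i < suc h
      within′ fzero    here       = z≤n , s≤s z≤n
      within′ (fsuc i) (there i∈) = z≤n , s≤s (≤-trans (proj₂ (within i i∈)) (m⊓n≤n d h))
      from-head : ∀ i → i ∈ A → suc s ≤ suc (toℕ i) × suc (toℕ i) ≤ d
      from-head i i∈ with within i i∈
      ... | far , near = s≤s far , ≤-trans near (m⊓n≤m d h)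
      apart′ : ∀ i j → i ∈ true ∷ A → j ∈ true ∷ A → i ≢ j →
               suc s ≤ ∣ toℕ i - toℕ j ∣ × ∣ toℕ i - toℕ j ∣ ≤ d
      apart′ fzero    fzero    _          _          i≢j = ⊥-elim (i≢j refl)
      apart′ fzero    (fsuc j) _          (there j∈) _   = from-head j j∈
      apart′ (fsuc i) fzero    (there i∈) _          _   = from-head i i∈
      apart′ (fsuc i) (fsuc j) (there i∈) (there j∈) i≢j = apart i j i∈ j∈ (λ eq → i≢j (cong fsuc eq))

  spread? : ∀ {n} → ℕ → ℕ → ℕ → Subset n → Bool
  spread? lo      hi      d []          = true
  spread? lo      hi      d (false ∷ A) = spread? (pred lo) (pred hi) d A
  spread? zero    (suc h) d (true ∷ A)  = spread? s (d ⊓ h) d A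
  spread? zero    zero    d (true ∷ A)  = false
  spread? (suc l) hi      d (true ∷ A)  = false

  spread?-sound : ∀ {n} lo hi d (A : Subset n) → spread? lo hi d A ≡ true → Spread lo hi d A
  spread?-sound lo      hi      d []          _  = spread (λ ()) (λ ())
  spread?-sound lo      hi      d (false ∷ A) ok = spread-skip⁺ (spread?-sound (pred lo) (pred hi) d A ok)
  spread?-sound zero    (suc h) d (true ∷ A)  ok = spread-use⁺ (spread?-sound s (d ⊓ h) d A ok)
  spread?-sound zero    zero    d (true ∷ A)  ()
  spread?-sound (suc l) hi      d (true ∷ A)  ()

  spread?-complete : ∀ {n} lo hi d (A : Subset n) → Spread lo hi d A → spread? lo hi d A ≡ true
  spread?-complete lo      hi      d []          _ = refl
  spread?-complete lo      hi      d (false ∷ A) S = spread?-complete (pred lo) (pred hi) d A (spread-skip⁻ S)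
  spread?-complete zero    (suc h) d (true ∷ A)  S = spread?-complete s (d ⊓ h) d A (proj₂ (proj₂ (spread-use⁻ S)))
  spread?-complete zero    zero    d (true ∷ A)  S with () ← proj₁ (proj₂ (spread-use⁻ S))
  spread?-complete (suc l) hi      d (true ∷ A)  S with () ← proj₁ (spread-use⁻ S)

  spreadCount : ℕ → ℕ → ℕ → ℕ → Series
  spreadCount n lo hi d = GF (spread? lo hi d) ∣_∣ (allSubsets n)

  usedFirst : ℕ → ℕ → ℕ → ℕ → Series
  usedFirst n zero    (suc h) d = X (spreadCount n s (d ⊓ h) d)
  usedFirst n zero    zero    d = λ _ → 0
  usedFirst n (suc l) hi      d = λ _ → 0

  spreadCount-suc : ∀ n lo hi d i →
    spreadCount (suc n) lo hi d i ≡ spreadCount n (pred lo) (pred hi) d i + usedFirst n lo hi d i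
  spreadCount-suc n lo hi d i = trans (∑-allSubsets-suc n (λ A → ⟦ spread? lo hi d A ⟧ * mono ∣ A ∣ i))
                                      (cong (spreadCount n (pred lo) (pred hi) d i +_) (used lo hi))
    where
      used : ∀ lo hi → ∑ (λ A → ⟦ spread? lo hi d (true ∷ A) ⟧ * X (mono ∣ A ∣) i) (allSubsets n) ≡ usedFirst n lo hi d i
      used zero    (suc h) = ∑-X (λ A → ⟦ spread? s (d ⊓ h) d A ⟧) (λ A → mono ∣ A ∣) (allSubsets n) i
      used zero    zero    = ∑-zero (allSubsets n)
      used (suc l) hi      = ∑-zero (allSubsets n)

  -- When the distance bound d does not restrict anything (hi ≤ d + 1), the
  -- spread subsets are the separated subsets of the path of cells
  -- [lo, min(hi, n)).
  window-count : ∀ n lo hi d → hi ≤ suc d → ∀ a → spreadCount n lo hi d a ≡ path ((hi ⊓ n) ∸ lo) a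
  window-count zero lo hi d _ a = begin
    1 * mono 0 a + 0          ≡⟨ trans (+-identityʳ _) (*-identityˡ _) ⟩
    one a                     ≡⟨ path-0 a ⟨
    path 0 a                  ≡⟨ cong (λ z → path z a) (trans (cong (_∸ lo) (⊓-zeroʳ hi)) (0∸n≡0 lo)) ⟨
    path ((hi ⊓ 0) ∸ lo) a    ∎
  window-count (suc n) (suc l) zero d _ a = begin
    spreadCount (suc n) (suc l) 0 d a       ≡⟨ spreadCount-suc n (suc l) 0 d a ⟩
    spreadCount n l 0 d a + 0               ≡⟨ +-identityʳ _ ⟩
    spreadCount n l 0 d a                   ≡⟨ window-count n l 0 d z≤n a ⟩
    path (0 ∸ l) a                          ≡⟨ cong (λ z → path z a) (trans (0∸n≡0 l) (sym (0∸n≡0 (suc l)))) ⟩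
    path (0 ∸ suc l) a                      ∎
  window-count (suc n) (suc l) (suc h) d h≤d a = begin
    spreadCount (suc n) (suc l) (suc h) d a ≡⟨ spreadCount-suc n (suc l) (suc h) d a ⟩
    spreadCount n l h d a + 0               ≡⟨ +-identityʳ _ ⟩
    spreadCount n l h d a                   ≡⟨ window-count n l h d (m≤n⇒m≤1+n (s≤s⁻¹ h≤d)) a ⟩
    path ((h ⊓ n) ∸ l) a                    ∎
  window-count (suc n) zero zero d _ a = begin
    spreadCount (suc n) 0 0 d a             ≡⟨ spreadCount-suc n 0 0 d a ⟩
    spreadCount n 0 0 d a + 0               ≡⟨ +-identityʳ _ ⟩
    spreadCount n 0 0 d a                   ≡⟨ window-count n 0 0 d z≤n a ⟩
    path 0 a                                ∎
  window-count (suc n) zero (suc h) d h≤d a = begin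
    spreadCount (suc n) 0 (suc h) d a
      ≡⟨ spreadCount-suc n 0 (suc h) d a ⟩
    spreadCount n 0 h d a + X (spreadCount n s (d ⊓ h) d) a
      ≡⟨ cong₂ _+_ (window-count n 0 h d (m≤n⇒m≤1+n (s≤s⁻¹ h≤d)) a)
                   (X-cong (window-count n s (d ⊓ h) d (≤-trans (m⊓n≤m d h) (n≤1+n d))) a) ⟩
    path (h ⊓ n) a + X (path (((d ⊓ h) ⊓ n) ∸ s)) a
      ≡⟨ cong (λ z → path (h ⊓ n) a + X (path ((z ⊓ n) ∸ s)) a) (m≥n⇒m⊓n≡n (s≤s⁻¹ h≤d)) ⟩
    path (h ⊓ n) a + X (path ((h ⊓ n) ∸ s)) a
      ≡⟨ path-suc (h ⊓ n) a ⟨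
    path (suc (h ⊓ n)) a ∎

  -- Subsets of a path of t + c + 1 cells with diameter at most c: either the
  -- first t cells are unused, leaving a path of c + 1 cells, or one of them
  -- is, and the others lie within the next c cells but s apart from it.
  diameter-count : ∀ t c i → spreadCount (t + suc c) 0 (t + suc c) c i ≡ path (suc c) i + t * X (path (c ∸ s)) i
  diameter-count zero c i = begin
    spreadCount (suc c) 0 (suc c) c i          ≡⟨ window-count (suc c) 0 (suc c) c ≤-refl i ⟩
    path (suc c ⊓ suc c) i                     ≡⟨ cong (λ z → path z i) (⊓-idem (suc c)) ⟩
    path (suc c) i                             ≡⟨ +-identityʳ _ ⟨
    path (suc c) i + 0 * X (path (c ∸ s)) i    ∎
  diameter-count (suc t) c i = begin
    spreadCount (suc m) 0 (suc m) c i
      ≡⟨ spreadCount-suc m 0 (suc m) c i ⟩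
    spreadCount m 0 m c i + X (spreadCount m s (c ⊓ m) c) i
      ≡⟨ cong₂ _+_ (diameter-count t c i) (X-cong rest i) ⟩
    path (suc c) i + t * X (path (c ∸ s)) i + X (path (c ∸ s)) i
      ≡⟨ +-assoc (path (suc c) i) _ _ ⟩
    path (suc c) i + (t * X (path (c ∸ s)) i + X (path (c ∸ s)) i)
      ≡⟨ cong (path (suc c) i +_) (+-comm (t * X (path (c ∸ s)) i) _) ⟩
    path (suc c) i + suc t * X (path (c ∸ s)) i ∎
    where
      m = t + suc c
      c⊓m≡c : c ⊓ m ≡ c
      c⊓m≡c = m≤n⇒m⊓n≡m (≤-trans (n≤1+n c) (m≤n+m (suc c) t))
      rest : ∀ e → spreadCount m s (c ⊓ m) c e ≡ path (c ∸ s) e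
      rest e = trans (window-count m s (c ⊓ m) c (≤-trans (m⊓n≤m c m) (n≤1+n c)) e)
                     (cong (λ z → path (z ∸ s) e) (trans (cong (_⊓ m) c⊓m≡c) c⊓m≡c))

  circle-count : ∀ n → suc s ≤ n → ∀ i → spreadCount n 0 n (n ∸ suc s) i ≡ cycle n i
  circle-count n s<n i with m≤n⇒∃[o]m+o≡n s<n
  ... | c , refl = begin
    spreadCount (suc s + c) 0 (suc s + c) (suc s + c ∸ suc s) i
      ≡⟨ cong₂ (λ M D → spreadCount M 0 M D i) (sym (+-suc s c)) (m+n∸m≡n (suc s) c) ⟩
    spreadCount (s + suc c) 0 (s + suc c) c i
      ≡⟨ diameter-count s c i ⟩
    path (suc c) i + s * X (path (c ∸ s)) i
      ≡⟨ cong₂ (λ x y → path x i + s * X (path y) i)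
               (trans (sym (m+n∸m≡n s (suc c))) (cong (_∸ s) (+-suc s c)))
               (sym ([m+n]∸[m+o]≡n∸o s c s)) ⟩
    cycle (suc s + c) i ∎

  -- Separation on a circle of m cells, for s ≥ 1, is spreadness with
  -- distances between s+1 and m-s-1: the distance D between two elements
  -- and the distance m - D around the other side must both exceed s.
  separatedCircle⇒spread : 1 ≤ s → ∀ {m} {A : Subset m} → SeparatedCircle s m A → Spread 0 m (m ∸ suc s) A
  separatedCircle⇒spread 1≤s {m} sep = spread (λ i _ → z≤n , Fin.toℕ<n i) apart
    where
      near : ∀ D → s ≤ D ∸ 1 → suc s ≤ D
      near zero    h with () ← ≤-trans 1≤s h
      near (suc D) h = s≤s h
      far : ∀ D → s ≤ m ∸ D ∸ 1 → D ≤ m ∸ suc s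
      far D h = m+n≤o⇒m≤o∸n D (subst (_≤ m) (solve 2 (λ s D → s :+ (D :+ con 1) := D :+ (con 1 :+ s)) refl s D)
                                     (positive-≤∸ s (D + 1) m 1≤s (subst (s ≤_) (∸-+-assoc m D 1) h)))
      apart : ∀ i j → i ∈ _ → j ∈ _ → i ≢ j → _
      apart i j i∈ j∈ i≢j with sep i j i≢j i∈ j∈
      ... | h₁ , h₂ = near _ h₁ , far _ h₂

  spread⇒separatedCircle : 1 ≤ s → ∀ {m} {A : Subset m} → Spread 0 m (m ∸ suc s) A → SeparatedCircle s m A
  spread⇒separatedCircle 1≤s {m} (spread _ apart) i j i≢j i∈ j∈ with apart i j i∈ j∈ i≢j
  ... | h₁ , h₂ = near _ h₁ , far _ h₁ h₂
    where
      near : ∀ D → suc s ≤ D → s ≤ D ∸ 1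
      near (suc D) (s≤s h) = h
      far : ∀ D → suc s ≤ D → D ≤ m ∸ suc s → s ≤ m ∸ D ∸ 1
      far D s<D D≤ = subst (s ≤_) (sym (∸-+-assoc m D 1))
        (m+n≤o⇒m≤o∸n s (subst (_≤ m) (solve 2 (λ s D → D :+ (con 1 :+ s) := s :+ (D :+ con 1)) refl s D)
                                (positive-≤∸ D (suc s) m (≤-trans (s≤s z≤n) s<D) D≤)))

  separated? : ∀ ms → Family ms → Bool
  separated? []       _       = true
  separated? (m ∷ ms) (A , F) = spread? 0 m (m ∸ suc s) A ∧ separated? ms F

  separated?-sound : 1 ≤ s → ∀ ms (F : Family ms) → separated? ms F ≡ true → Separated s ms F
  separated?-sound 1≤s []       _       _  = tt
  separated?-sound 1≤s (m ∷ ms) (A , F) ok =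
    spread⇒separatedCircle 1≤s (spread?-sound 0 m (m ∸ suc s) A (∧-conicalˡ _ _ ok)) ,
    separated?-sound 1≤s ms F (∧-conicalʳ _ _ ok)

  separated?-complete : 1 ≤ s → ∀ ms (F : Family ms) → Separated s ms F → separated? ms F ≡ true
  separated?-complete 1≤s []       _       _           = refl
  separated?-complete 1≤s (m ∷ ms) (A , F) (sepA , sepF) =
    cong₂ _∧_ (spread?-complete 0 m (m ∸ suc s) A (separatedCircle⇒spread 1≤s sepA)) (separated?-complete 1≤s ms F sepF)

  circleGF : ℕ → Series
  circleGF m = spreadCount m 0 m (m ∸ suc s)

  familyGF : List ℕ → Series
  familyGF ms = GF (separated? ms) (size ms) (allFamilies ms)

  familyGF-[] : ∀ j → familyGF [] j ≡ one j
  familyGF-[] zero    = refl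
  familyGF-[] (suc j) = refl

  familyGF-∷ : ∀ m ms j → familyGF (m ∷ ms) j ≡ (circleGF m ⋆ familyGF ms) j
  familyGF-∷ m ms = GF-product (spread? 0 m (m ∸ suc s)) (separated? ms) ∣_∣ (size ms) (allSubsets m) (allFamilies ms)

  spreadCount-zero : ∀ n lo hi d → spreadCount n lo hi d 0 ≡ 1
  spreadCount-zero zero    lo hi d = refl
  spreadCount-zero (suc n) lo hi d =
    trans (spreadCount-suc n lo hi d 0) (trans (cong₂ _+_ (spreadCount-zero n (pred lo) (pred hi) d) (used lo hi)) refl)
    where
      used : ∀ lo hi → usedFirst n lo hi d 0 ≡ 0
      used zero    (suc h) = refl
      used zero    zero    = refl
      used (suc l) hi      = refl

  merge-all : 1 ≤ s → ∀ ms j L → s * j ≤ L + s → All (λ m → s * suc j ≤ m) ms →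
              (path L ⋆ familyGF ms) j ≡ path (L + sum ms) j
  merge-all 1≤s [] j L _ [] = begin
    (path L ⋆ familyGF []) j   ≡⟨ ⋆-congʳ j (path L) familyGF-[] ⟩
    (path L ⋆ one) j           ≡⟨ ⋆-identityʳ j (path L) ⟩
    path L j                   ≡⟨ cong (λ z → path z j) (+-identityʳ L) ⟨
    path (L + 0) j             ∎
  merge-all 1≤s (m ∷ ms) j L hL (hm ∷ hms) = begin
    (path L ⋆ familyGF (m ∷ ms)) j         ≡⟨ ⋆-congʳ j (path L) (familyGF-∷ m ms) ⟩
    (path L ⋆ (circleGF m ⋆ familyGF ms)) j ≡⟨ ⋆-assoc j (path L) (circleGF m) (familyGF ms) ⟨
    ((path L ⋆ circleGF m) ⋆ familyGF ms) j ≡⟨ ⋆-cong j merged (λ _ _ → refl) ⟩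
    (path (L + m) ⋆ familyGF ms) j         ≡⟨ merge-all 1≤s ms j (L + m) (≤-trans hL (+-monoˡ-≤ s (m≤m+n L m))) hms ⟩
    path (L + m + sum ms) j                ≡⟨ cong (λ z → path z j) (+-assoc L m (sum ms)) ⟩
    path (L + (m + sum ms)) j              ∎
    where
      merged : ∀ i → i ≤ j → (path L ⋆ circleGF m) i ≡ path (L + m) i
      merged zero    _   = trans (+-identityʳ _) (spreadCount-zero m 0 m (m ∸ suc s))
      merged (suc i) i<j = trans (⋆-congʳ (suc i) (path L) (circle-count m s<m)) (merge 1≤s (suc i) L m hL′ hm′)
        where
          hL′ : s * suc i ≤ L + s
          hL′ = ≤-trans (*-monoʳ-≤ s i<j) hL
          hm′ : s * suc (suc i) ≤ m
          hm′ = ≤-trans (*-monoʳ-≤ s (s≤s i<j)) hm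
          s<m : suc s ≤ m
          s<m = ≤-trans (s<s*[2+i] 1≤s i) hm′

  throughFirst? : ∀ {n} → Subset (suc n) → Bool
  throughFirst? {n} A = head A ∧ spread? 0 (suc n) (n ∸ s) A

  -- Their generating function is x times that of the path of the n - 2s
  -- cells at distance more than s from cell 0.
  throughFirstGF : ∀ n i → GF throughFirst? ∣_∣ (allSubsets (suc n)) i ≡ X (path (n ∸ (s + s))) i
  throughFirstGF n i = begin
    GF throughFirst? ∣_∣ (allSubsets (suc n)) i
      ≡⟨ ∑-allSubsets-suc n (λ A → ⟦ throughFirst? A ⟧ * mono ∣ A ∣ i) ⟩
    ∑ (λ _ → 0) (allSubsets n) + ∑ (λ A → ⟦ spread? s (d ⊓ n) d A ⟧ * X (mono ∣ A ∣) i) (allSubsets n)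
      ≡⟨ cong₂ _+_ (∑-zero (allSubsets n))
                   (∑-X (λ A → ⟦ spread? s (d ⊓ n) d A ⟧) (λ A → mono ∣ A ∣) (allSubsets n) i) ⟩
    X (spreadCount n s (d ⊓ n) d) i
      ≡⟨ X-cong (λ e → window-count n s (d ⊓ n) d (≤-trans (m⊓n≤m d n) (n≤1+n d)) e) i ⟩
    X (path (((d ⊓ n) ⊓ n) ∸ s)) i
      ≡⟨ X-cong (λ e → cong (λ z → path z e) (trans (cong (_∸ s) (trans (cong (_⊓ n) d⊓n≡d) d⊓n≡d))
                                                     (∸-+-assoc n s s))) i ⟩
    X (path (n ∸ (s + s))) i ∎
    where
      d = n ∸ s
      d⊓n≡d : d ⊓ n ≡ d
      d⊓n≡d = m≤n⇒m⊓n≡m (m∸n≤m n s)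

  through-cell-0 : ∀ {n ms} (A : Subset (suc n)) (F : Family ms) → head A ≡ true ⇔ Contains11 (suc n) ms (A , F)
  through-cell-0 (a ∷ A) F = mk⇔ (λ { refl → fzero , refl , here }) head-used
    where
      head-used : Contains11 _ _ (a ∷ A , F) → a ≡ true
      head-used (fzero , _ , here) = refl

  in𝒜? : ℕ → ∀ n ms → Family (suc n ∷ ms) → Bool
  in𝒜? k n ms (A , F) = (throughFirst? A ∧ separated? ms F) ∧ (∣ A ∣ + size ms F ≡ᵇ k)

  in𝒜?-correct : 1 ≤ s → ∀ k n ms (F : Family (suc n ∷ ms)) → in𝒜? k n ms F ≡ true ⇔ 𝒜 s k (suc n) ms F
  in𝒜?-correct 1≤s k n ms (A , F) = mk⇔ to from
    where
      to : in𝒜? k n ms (A , F) ≡ true → 𝒜 s k (suc n) ms (A , F)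
      to ok with ∧-conicalˡ _ _ ok | ∧-conicalʳ _ _ ok
      ... | parts | sized with ∧-conicalˡ _ _ parts | ∧-conicalʳ _ _ parts
      ...   | first | rest =
        ((spread⇒separatedCircle 1≤s (spread?-sound 0 (suc n) (n ∸ s) A (∧-conicalʳ _ _ first)) ,
          separated?-sound 1≤s ms F rest) ,
         ≡ᵇ⇒≡ _ _ (Equivalence.from T-≡ sized)) ,
        Equivalence.to (through-cell-0 A F) (∧-conicalˡ _ _ first)
      from : 𝒜 s k (suc n) ms (A , F) → in𝒜? k n ms (A , F) ≡ true
      from (((sepA , sepF) , sized) , c11) =
        cong₂ _∧_ (cong₂ _∧_ (cong₂ _∧_ (Equivalence.from (through-cell-0 A F) c11)
                                        (spread?-complete 0 (suc n) (n ∸ s) A (separatedCircle⇒spread 1≤s sepA)))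
                             (separated?-complete 1≤s ms F sepF))
                  (Equivalence.to T-≡ (≡⇒≡ᵇ _ _ sized))

  in𝒜?-count : ∀ k n ms → ∑ (λ F → ⟦ in𝒜? k n ms F ⟧) (allFamilies (suc n ∷ ms))
                         ≡ (GF throughFirst? ∣_∣ (allSubsets (suc n)) ⋆ familyGF ms) k
  in𝒜?-count k n ms =
    trans (∑-cong weigh (allFamilies (suc n ∷ ms)))
          (GF-product throughFirst? (separated? ms) ∣_∣ (size ms) (allSubsets (suc n)) (allFamilies ms) k)
    where
      weigh : ∀ F → ⟦ in𝒜? k n ms F ⟧
                  ≡ ⟦ throughFirst? (proj₁ F) ∧ separated? ms (proj₂ F) ⟧ * mono (size (suc n ∷ ms) F) k
      weigh (A , F) = trans (⟦∧⟧ (throughFirst? A ∧ separated? ms F) _)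
                            (cong (⟦ throughFirst? A ∧ separated? ms F ⟧ *_) (mono-≡ᵇ (∣ A ∣ + size ms F) k))

  final-bound : ∀ j n → s * suc j ≤ n → s * j ≤ (n ∸ (s + s)) + s
  final-bound zero    n _ = subst (_≤ (n ∸ (s + s)) + s) (sym (*-zeroʳ s)) z≤n
  final-bound (suc e) n h =
    subst (_≤ (n ∸ (s + s)) + s) (trans (+-comm (s * e) s) (sym (*-suc s e)))
          (+-monoˡ-≤ s (m+n≤o⇒m≤o∸n (s * e) (subst (_≤ n) (two-gaps e) h)))
    where
      two-gaps : ∀ e → s * suc (suc e) ≡ s * e + (s + s)
      two-gaps e = trans (*-suc s (suc e)) (trans (cong (s +_) (*-suc s e))
                         (solve 2 (λ s x → s :+ (s :+ x) := x :+ (s :+ s)) refl s (s * e)))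

  final-value : ∀ j n S → s * suc j ≤ n → path ((n ∸ (s + s)) + S) j ≡ ((suc n + S) ∸ s * suc j ∸ 1) C j
  final-value zero    n S _ = sym (nC0≡1 ((suc n + S) ∸ s * 1 ∸ 1))
  final-value (suc e) n S h with m≤n⇒∃[o]m+o≡n h
  ... | r , refl = cong (_C suc e) (trans left (sym right))
    where
      Q = s * suc (suc e)
      Q≡ : Q ≡ (s + s) + s * e
      Q≡ = trans (*-suc s (suc e)) (trans (cong (s +_) (*-suc s e)) (sym (+-assoc s s (s * e))))
      left : ((Q + r) ∸ (s + s)) + S ∸ s * e ≡ r + S
      left = begin
        ((Q + r) ∸ (s + s)) + S ∸ s * e              ≡⟨ cong (λ z → ((z + r) ∸ (s + s)) + S ∸ s * e) Q≡ ⟩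
        ((s + s + s * e + r) ∸ (s + s)) + S ∸ s * e  ≡⟨ cong (λ z → (z ∸ (s + s)) + S ∸ s * e) (+-assoc (s + s) (s * e) r) ⟩
        ((s + s + (s * e + r)) ∸ (s + s)) + S ∸ s * e ≡⟨ cong (λ z → z + S ∸ s * e) (m+n∸m≡n (s + s) (s * e + r)) ⟩
        s * e + r + S ∸ s * e                        ≡⟨ cong (_∸ s * e) (+-assoc (s * e) r S) ⟩
        s * e + (r + S) ∸ s * e                      ≡⟨ m+n∸m≡n (s * e) (r + S) ⟩
        r + S                                        ∎
      right : (suc (Q + r) + S) ∸ Q ∸ 1 ≡ r + S
      right = trans (cong (λ z → z ∸ Q ∸ 1) (solve 3 (λ Q r S → con 1 :+ (Q :+ r) :+ S := Q :+ (con 1 :+ (r :+ S))) refl Q r S))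
                    (cong (_∸ 1) (m+n∸m≡n Q (suc (r + S))))

  -- The number of sets in 𝒜^{s,k}_{(1,1)}(n+1, ms) as a coefficient: it is
  -- that of x^j in path (n - 2s) ⋆ ∏ cycle mᵢ = path (n - 2s + Σ mᵢ).
  count-𝒜 : 1 ≤ s → ∀ j n ms → s * suc j ≤ n → All (λ m → s * suc j ≤ m) ms →
            ∑ (λ F → ⟦ in𝒜? (suc j) n ms F ⟧) (allFamilies (suc n ∷ ms)) ≡ ((suc n + sum ms) ∸ s * suc j ∸ 1) C j
  count-𝒜 1≤s j n ms bound₁ bounds = begin
    ∑ (λ F → ⟦ in𝒜? (suc j) n ms F ⟧) (allFamilies (suc n ∷ ms))
      ≡⟨ in𝒜?-count (suc j) n ms ⟩
    (GF throughFirst? ∣_∣ (allSubsets (suc n)) ⋆ familyGF ms) (suc j)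
      ≡⟨ ⋆-congˡ (suc j) (familyGF ms) (throughFirstGF n) ⟩
    (X (path (n ∸ (s + s))) ⋆ familyGF ms) (suc j)
      ≡⟨ ⋆-Xˡ (suc j) (path (n ∸ (s + s))) (familyGF ms) ⟩
    (path (n ∸ (s + s)) ⋆ familyGF ms) j
      ≡⟨ merge-all 1≤s ms j (n ∸ (s + s)) (final-bound j n bound₁) bounds ⟩
    path ((n ∸ (s + s)) + sum ms) j
      ≡⟨ final-value j n (sum ms) bound₁ ⟩
    ((suc n + sum ms) ∸ s * suc j ∸ 1) C j ∎

-- The hypotheses exclude k = 0 and n₁ = 0; otherwise 𝒜 is enumerated by the
-- test in𝒜?, whose count is given by count-𝒜.
theorem3 : (s k n₁ : ℕ) (ns : List ℕ) → 1 ≤ s → 1 ≤ k →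
    s * k + 1 ≤ n₁ → All (λ nᵢ → s * k ≤ nᵢ) ns →
    HasCard {n₁ ∷ ns} (𝒜 s k n₁ ns) (((n₁ + sum ns) ∸ s * k ∸ 1) C (k ∸ 1))
theorem3 s zero    _       ns _   ()  _      _
theorem3 s (suc j) zero    ns _   _   bound₁ _ with () ← ≤-trans (m≤n+m 1 (s * suc j)) bound₁
theorem3 s (suc j) (suc n) ns 1≤s _   bound₁ bounds =
  subst (HasCard (𝒜 s (suc j) (suc n) ns))
        (count-𝒜 s 1≤s j n ns (s≤s⁻¹ (subst (_≤ suc n) (+-comm (s * suc j) 1) bound₁)) bounds)
        (hasCard-by-test (𝒜 s (suc j) (suc n) ns) (in𝒜? s (suc j) n ns) (in𝒜?-correct s 1≤s (suc j) n ns))
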